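{- Let $t$ be a positive integer, let $n\ge t+1$ and let $\mathcal A\in I(n,t)$. Then $s_{min}(G(\mathcal A))\ge t$. Furthermore, if $s_{min}(G(\mathcal A))=t$, then $\mathcal A$ is the stabilizer of $t$ points.
   Context: $S_n$ is the symmetric group on $[n]=\{1,\dots,n\}$; $\mathrm{fix}(\sigma)=\{x:\sigma(x)=x\}$. Two permutations have a cycle in common if that cycle appears in both cycle decompositions (1-cycles count). A family $\mathcal A\subseteq S_n$ is $t$-cycle-intersecting if any two distinct members have at least $t$ cycles in common; $I(n,t)$ is the collection of all such families. The stabilizer of $t$ points is a family $\{\sigma\in S_n:\sigma(a_k)=a_k,\ k=1,\dots,t\}$ for some distinct $a_1,\dots,a_t$. For $B\subseteq[n]$, $\mathscr U_p(B)=\{\sigma\in S_n: B\subseteq\mathrm{fix}(\sigma)\}$, and $\mathscr U_p(\mathcal B)=\bigcup_{B\in\mathcal B}\mathscr U_p(B)$. A collection $g$ of subsets of $[n]$ is a generating set for $\mathcal A$ if $g$ contains no set of cardinality $n-1$ and $\mathscr U_p(g)=\mathcal A$; $G(\mathcal A)$ is the set of all generating sets. For $B\subseteq[n]$, $s^+(B)$ is the largest element of $B$; $s^+(g)=\max\{s^+(B):B\in g\}$; $s_{min}(G(\mathcal A))=\min\{s^+(g):g\in G(\mathcal A)\}$. -}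

module Defs where

open import Data.Nat using (ℕ; zero; suc; _≤_; _⊔_; _∸_)
open import Data.Fin using (Fin; toℕ)
open import Data.Vec using (Vec; lookup)
open import Data.List using (List; foldr; allFin)
open import Data.List.Relation.Unary.All using (All)
open import Data.List.Relation.Unary.Any using (Any)
import Data.List.Membership.Propositional as LM
open import Data.Fin.Subset as S using (Subset; ∣_∣; inside)
open import Data.Bool using (if_then_else_)
open import Data.Product using (Σ; ∃; _×_)
open import Relation.Nullary using (¬_)
open import Relation.Binary.PropositionalEquality using (_≡_; _≢_)
open import Function.Bundles using (_⇔_)

-- A map [n] → [n] is encoded by its table σ with σ(x) = lookup σ x.
-- (Fin n = {0,…,n-1} plays the role of [n] = {1,…,n} via x ↦ toℕ x + 1.)
Map : ℕ → Set
Map n = Vec (Fin n) n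

-- σ is a permutation of [n] (injective, hence bijective on a finite set).
IsPerm : ∀ {n} → Map n → Set
IsPerm {n} σ = ∀ (i j : Fin n) → lookup σ i ≡ lookup σ j → i ≡ j

iter : ∀ {n} → Map n → ℕ → Fin n → Fin n
iter σ zero x = x
iter σ (suc k) x = lookup σ (iter σ k x)

IsCycleOf : ∀ {n} → Map n → Subset n → Set
IsCycleOf {n} σ O =
  ∃ λ (x : Fin n) → (x S.∈ O) ×
    (∀ (y : Fin n) → (y S.∈ O) ⇔ (∃ λ (k : ℕ) → iter σ k x ≡ y))

-- The cycle of σ with support O also appears in τ's cycle decomposition:
-- O is a σ-cycle and τ acts on O exactly as σ does.
IsCommonCycle : ∀ {n} → Map n → Map n → Subset n → Set
IsCommonCycle {n} σ τ O =
  IsCycleOf σ O × (∀ (y : Fin n) → y S.∈ O → lookup σ y ≡ lookup τ y)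

CommonAtLeast : ∀ {n} → ℕ → Map n → Map n → Set
CommonAtLeast {n} t σ τ =
  ∃ λ (C : Vec (Subset n) t) →
    (∀ (i j : Fin t) → lookup C i ≡ lookup C j → i ≡ j) ×
    (∀ (i : Fin t) → IsCommonCycle σ τ (lookup C i))

-- A family of permutations of [n] is given as a finite list (a set; duplicates irrelevant).
Family : ℕ → Set
Family n = List (Map n)

InI : (n t : ℕ) → Family n → Set
InI n t A =
  All IsPerm A ×
  (∀ (σ τ : Map n) → σ LM.∈ A → τ LM.∈ A → σ ≢ τ → CommonAtLeast t σ τ)

_⊆fix_ : ∀ {n} → Subset n → Map n → Set
_⊆fix_ {n} B σ = ∀ (x : Fin n) → x S.∈ B → lookup σ x ≡ x

IsGen : ∀ {n} → Family n → List (Subset n) → Set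
IsGen {n} A g =
  All (λ B → ∣ B ∣ ≢ n ∸ 1) g ×
  (∀ (σ : Map n) → IsPerm σ → (σ LM.∈ A) ⇔ Any (λ B → B ⊆fix σ) g)

-- s⁺(B): largest element of B (as an element of [n] = {1,…,n}); 0 if B = ∅.
s⁺ : ∀ {n} → Subset n → ℕ
s⁺ {n} B = foldr (λ i acc → (if lookup B i then suc (toℕ i) else 0) ⊔ acc) 0 (allFin n)

s⁺g : ∀ {n} → List (Subset n) → ℕ
s⁺g g = foldr (λ B acc → s⁺ B ⊔ acc) 0 g

SMinIs : ∀ {n} → Family n → ℕ → Set
SMinIs {n} A m =
  (∃ λ (g : List (Subset n)) → IsGen A g × s⁺g g ≡ m) ×
  (∀ (g : List (Subset n)) → IsGen A g → m ≤ s⁺g g)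

IsStabilizer : ∀ {n} → ℕ → Family n → Set
IsStabilizer {n} t A =
  ∃ λ (a : Vec (Fin n) t) →
    (∀ (i j : Fin t) → lookup a i ≡ lookup a j → i ≡ j) ×
    (∀ (σ : Map n) → IsPerm σ →
       (σ LM.∈ A) ⇔ (∀ (k : Fin t) → lookup σ (lookup a k) ≡ lookup a k))

module Submission where

-- The heart of the proof is "prefix-generator-is-full": if a generator B of A lies
-- inside the prefix [0,t) (points are 0-based here), then B contains all of [0,t).
-- Otherwise pick j ∈ [0,t) \ B.  Both the identity ι and the cycle
-- τ = (j t t+1 … n-1) fix B pointwise, so both lie in A; but the cycles ι and τ
-- share are exactly the fixed points of τ, namely [0,t) \ {j}, and these are
-- only t-1 points (a pigeonhole count), contradicting t-cycle-intersection.

open import Defs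
open import Data.Nat using (ℕ; _≤_; _+_)
open import Data.List using ([])
open import Data.Product using (_×_)
open import Relation.Binary.PropositionalEquality using (_≢_)

open import Data.Nat using (zero; suc; s≤s; pred; _<_; _⊔_; _≟_; _<?_; _≤?_)
open import Data.Nat.Properties
  using (≤-refl; ≤-antisym; ≤-trans; <-trans; <-≤-trans; <-irrefl; <-asym; <⇒≤; ≮⇒≥; ≰⇒>;
         1+n≢n; 1+n≰n; m≤m⊔n; m≤n⊔m; +-comm)
open import Data.Fin using (Fin; toℕ; fromℕ<; punchOut; inject≤)
open import Data.Fin.Properties
  using (toℕ-injective; toℕ<n; toℕ-fromℕ<; fromℕ<-injective; toℕ-inject≤;
         punchOut-injective; injective⇒≤)
open import Data.Vec using (Vec; lookup; tabulate)
open import Data.Vec.Properties using (lookup∘tabulate; []=⇒lookup)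
open import Data.List using (List; _∷_; foldr)
open import Data.List.Relation.Unary.All using (All; _∷_)
open import Data.List.Relation.Unary.Any using (here; there)
open import Data.List.Membership.Propositional using (_∈_; find; lose)
open import Data.List.Membership.Propositional.Properties using (∈-allFin)
open import Data.Fin.Subset as S using (Subset)
open import Data.Fin.Subset.Properties using (⊆-antisym; _∈?_)
open import Data.Bool using (if_then_else_)
open import Data.Product using (∃; _,_; proj₁; proj₂)
open import Data.Empty using (⊥-elim)
open import Function.Definitions using (Injective)
open import Relation.Nullary using (¬_; yes; no; contradiction)
open import Relation.Binary.PropositionalEquality using (_≡_; refl; sym; trans; cong; subst; module ≡-Reasoning)
open import Function.Bundles using (_⇔_; Equivalence; mk⇔)

open Equivalence using (to; from)

Below : ∀ {n} → ℕ → Subset n → Set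
Below {n} t B = ∀ (x : Fin n) → x S.∈ B → toℕ x < t

FixesPrefix : ∀ {n} → ℕ → Map n → Set
FixesPrefix {n} t σ = ∀ (x : Fin n) → toℕ x < t → lookup σ x ≡ x

ι : ∀ {n} → Map n
ι = tabulate (λ x → x)

lookup-ι : ∀ {n} (x : Fin n) → lookup ι x ≡ x
lookup-ι = lookup∘tabulate (λ x → x)

iter-ι : ∀ {n} k (x : Fin n) → iter ι k x ≡ x
iter-ι zero    x = refl
iter-ι (suc k) x = trans (cong (lookup ι) (iter-ι k x)) (lookup-ι x)

ι-perm : ∀ {n} → IsPerm (ι {n})
ι-perm i j eq = trans (sym (lookup-ι i)) (trans eq (lookup-ι j))

-- The cycle (J t t+1 … n-1) as a map on ℕ, for J < t < n; it fixes every other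
-- point of [0,t).  "cyc⁻¹" is its inverse on [0,n).
module Cycle (n t J : ℕ) (J<t : J < t) (t<n : t < n) where

  cyc : ℕ → ℕ
  cyc x with x ≟ J
  ... | yes _ = t
  ... | no _ with x <? t
  ...   | yes _ = x
  ...   | no _ with suc x <? n
  ...     | yes _ = suc x
  ...     | no _ = J

  data CycView (x : ℕ) : ℕ → Set where
    at-J   : x ≡ J → CycView x t
    fixed  : x ≢ J → x < t → CycView x x
    step   : x ≢ J → t ≤ x → suc x < n → CycView x (suc x)
    wrap   : x ≢ J → t ≤ x → ¬ suc x < n → CycView x J

  view : ∀ x → CycView x (cyc x)
  view x with x ≟ J
  ... | yes x≡J = at-J x≡J
  ... | no x≢J with x <? t
  ...   | yes x<t = fixed x≢J x<t
  ...   | no x≮t with suc x <? n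
  ...     | yes x+1<n = step x≢J (≮⇒≥ x≮t) x+1<n
  ...     | no x+1≮n = wrap x≢J (≮⇒≥ x≮t) x+1≮n

  cyc-bound : ∀ x → x < n → cyc x < n
  cyc-bound x x<n with cyc x | view x
  ... | _ | at-J _         = t<n
  ... | _ | fixed _ _      = x<n
  ... | _ | step _ _ x+1<n = x+1<n
  ... | _ | wrap _ _ _     = <-trans J<t t<n

  cyc-fixes : ∀ x → x < t → x ≢ J → cyc x ≡ x
  cyc-fixes x x<t x≢J with cyc x | view x
  ... | _ | at-J x≡J     = contradiction x≡J x≢J
  ... | _ | fixed _ _    = refl
  ... | _ | step _ t≤x _ = contradiction (<-≤-trans x<t t≤x) (<-irrefl refl)
  ... | _ | wrap _ t≤x _ = contradiction (<-≤-trans x<t t≤x) (<-irrefl refl)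

  cyc-fixed : ∀ x → cyc x ≡ x → x < t × x ≢ J
  cyc-fixed x fx with cyc x | view x
  ... | _ | at-J refl     = ⊥-elim (<-irrefl (sym fx) J<t)
  ... | _ | fixed x≢J x<t = x<t , x≢J
  ... | _ | step _ _ _    = contradiction fx 1+n≢n
  ... | _ | wrap x≢J _ _  = contradiction (sym fx) x≢J

  cyc⁻¹ : ℕ → ℕ
  cyc⁻¹ y with y ≟ J
  ... | yes _ = pred n
  ... | no _ with y <? t
  ...   | yes _ = y
  ...   | no _ with y ≟ t
  ...     | yes _ = J
  ...     | no _ = pred y

  cyc⁻¹-J : cyc⁻¹ J ≡ pred n
  cyc⁻¹-J with J ≟ J
  ... | yes _   = refl
  ... | no J≢J = contradiction refl J≢J

  cyc⁻¹-fixes : ∀ y → y < t → y ≢ J → cyc⁻¹ y ≡ y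
  cyc⁻¹-fixes y y<t y≢J with y ≟ J
  ... | yes y≡J = contradiction y≡J y≢J
  ... | no _ with y <? t
  ...   | yes _   = refl
  ...   | no y≮t = contradiction y<t y≮t

  cyc⁻¹-t : cyc⁻¹ t ≡ J
  cyc⁻¹-t with t ≟ J
  ... | yes t≡J = ⊥-elim (<-irrefl (sym t≡J) J<t)
  ... | no _ with t <? t
  ...   | yes t<t = contradiction t<t (<-irrefl refl)
  ...   | no _ with t ≟ t
  ...     | yes _   = refl
  ...     | no t≢t = contradiction refl t≢t

  cyc⁻¹-above : ∀ y → t < y → cyc⁻¹ y ≡ pred y
  cyc⁻¹-above y t<y with y ≟ J
  ... | yes refl = contradiction (<-trans J<t t<y) (<-irrefl refl)
  ... | no _ with y <? t
  ...   | yes y<t = contradiction y<t (<-asym t<y)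
  ...   | no _ with y ≟ t
  ...     | yes refl = contradiction t<y (<-irrefl refl)
  ...     | no _    = refl

  cyc⁻¹∘cyc : ∀ x → x < n → cyc⁻¹ (cyc x) ≡ x
  cyc⁻¹∘cyc x x<n with cyc x | view x
  ... | _ | at-J refl         = cyc⁻¹-t
  ... | _ | fixed x≢J x<t     = cyc⁻¹-fixes x x<t x≢J
  ... | _ | step _ t≤x _      = cyc⁻¹-above (suc x) (s≤s t≤x)
  ... | _ | wrap _ _ x+1≮n    =
    trans cyc⁻¹-J (cong pred (≤-antisym (≮⇒≥ x+1≮n) x<n))

ι-cycle-singleton : ∀ {n} {O : Subset n} (c : IsCycleOf ι O) → ∀ y → y S.∈ O → y ≡ proj₁ c
ι-cycle-singleton (x , _ , orbit) y y∈O with to (orbit y) y∈O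
... | k , ιᵏx≡y = trans (sym ιᵏx≡y) (iter-ι k x)

ι-cycle-⊆ : ∀ {n} {O O′ : Subset n} (c : IsCycleOf ι O) (c′ : IsCycleOf ι O′) →
  proj₁ c ≡ proj₁ c′ → O S.⊆ O′
ι-cycle-⊆ c c′ same-base {y} y∈O =
  subst (S._∈ _) (sym (trans (ι-cycle-singleton c y y∈O) same-base)) (proj₁ (proj₂ c′))

common-with-ι⇒fixed-points : ∀ {n k} {τ : Map n} → CommonAtLeast k ι τ →
  ∃ λ (p : Fin k → Fin n) → Injective _≡_ _≡_ p × (∀ i → lookup τ (p i) ≡ p i)
common-with-ι⇒fixed-points {n} {k} {τ} (C , C-distinct , common) = base , base-injective , base-fixed
  where
  base : Fin k → Fin n
  base i = proj₁ (proj₁ (common i))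

  base-fixed : ∀ i → lookup τ (base i) ≡ base i
  base-fixed i =
    trans (sym (proj₂ (common i) (base i) (proj₁ (proj₂ (proj₁ (common i))))))
          (lookup-ι (base i))

  base-injective : Injective _≡_ _≡_ base
  base-injective {i} {i′} same-base = C-distinct i i′
    (⊆-antisym (ι-cycle-⊆ (proj₁ (common i)) (proj₁ (common i′)) same-base)
               (ι-cycle-⊆ (proj₁ (common i′)) (proj₁ (common i)) (sym same-base)))

no-injection-into-punctured-prefix : ∀ {m n} (j : Fin n) → toℕ j < m →
  (p : Fin m → Fin n) → Injective _≡_ _≡_ p → ¬ (∀ i → toℕ (p i) < m × p i ≢ j)
no-injection-into-punctured-prefix {suc m} j j<m p p-injective inside =
  1+n≰n (injective⇒≤ q-injective)
  where
  j′ : Fin (suc m)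
  j′ = fromℕ< j<m

  -- p, viewed inside Fin (suc m), and then squeezed into Fin m by removing j.
  p′ : Fin (suc m) → Fin (suc m)
  p′ i = fromℕ< (proj₁ (inside i))

  p′-injective : Injective _≡_ _≡_ p′
  p′-injective eq = p-injective (toℕ-injective (fromℕ<-injective _ _ _ _ eq))

  j′∉p′ : ∀ i → j′ ≢ p′ i
  j′∉p′ i eq = proj₂ (inside i) (toℕ-injective (sym (fromℕ<-injective _ _ _ _ eq)))

  q : Fin (suc m) → Fin m
  q i = punchOut (j′∉p′ i)

  q-injective : Injective _≡_ _≡_ q
  q-injective eq = p′-injective (punchOut-injective (j′∉p′ _) (j′∉p′ _) eq)

module PuncturedCycle {n t : ℕ} (j : Fin n) (j<t : toℕ j < t) (t<n : t < n) where
  open Cycle n t (toℕ j) j<t t<n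

  τ : Map n
  τ = tabulate (λ x → fromℕ< (cyc-bound (toℕ x) (toℕ<n x)))

  toℕ-τ : ∀ x → toℕ (lookup τ x) ≡ cyc (toℕ x)
  toℕ-τ x = trans (cong toℕ (lookup∘tabulate _ x)) (toℕ-fromℕ< _)

  τ-perm : IsPerm τ
  τ-perm x y τx≡τy = toℕ-injective (begin
    toℕ x                 ≡⟨ sym (cyc⁻¹∘cyc (toℕ x) (toℕ<n x)) ⟩
    cyc⁻¹ (cyc (toℕ x))   ≡⟨ cong cyc⁻¹ (trans (sym (toℕ-τ x)) (cong toℕ τx≡τy)) ⟩
    cyc⁻¹ (toℕ (lookup τ y)) ≡⟨ cong cyc⁻¹ (toℕ-τ y) ⟩
    cyc⁻¹ (cyc (toℕ y))   ≡⟨ cyc⁻¹∘cyc (toℕ y) (toℕ<n y) ⟩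
    toℕ y                 ∎)
    where open ≡-Reasoning

  τ-fixes : ∀ x → toℕ x < t → x ≢ j → lookup τ x ≡ x
  τ-fixes x x<t x≢j = toℕ-injective
    (trans (toℕ-τ x) (cyc-fixes (toℕ x) x<t (λ x≡j → x≢j (toℕ-injective x≡j))))

  τ-fixed : ∀ x → lookup τ x ≡ x → toℕ x < t × x ≢ j
  τ-fixed x τx≡x with cyc-fixed (toℕ x) (trans (sym (toℕ-τ x)) (cong toℕ τx≡x))
  ... | x<t , x≢j = x<t , (λ x≡j → x≢j (cong toℕ x≡j))

  ι≢τ : ι ≢ τ
  ι≢τ ι≡τ = proj₂ (τ-fixed j (subst (λ σ → lookup σ j ≡ j) ι≡τ (lookup-ι j))) refl

  -- ι and τ share only the t-1 one-point cycles {x}, x ∈ [0,t) \ {j}.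
  ι-τ-share-fewer-than-t : ¬ CommonAtLeast t ι τ
  ι-τ-share-fewer-than-t common with common-with-ι⇒fixed-points {τ = τ} common
  ... | p , p-injective , p-fixed =
    no-injection-into-punctured-prefix j j<t p p-injective (λ i → τ-fixed (p i) (p-fixed i))

prefix-generator-is-full : ∀ {n t} {A : Family n} {B : Subset n} → InI n t A → t < n →
  (∀ σ → IsPerm σ → B ⊆fix σ → σ ∈ A) → Below t B →
  ∀ (j : Fin n) → toℕ j < t → j S.∈ B
prefix-generator-is-full {A = A} {B} (_ , intersecting) t<n stabilizer⊆A B<t j j<t
  with j ∈? B
... | yes j∈B = j∈B
... | no j∉B = contradiction (intersecting ι τ ι∈A τ∈A ι≢τ) ι-τ-share-fewer-than-t
  where
  open PuncturedCycle j j<t t<n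

  ι∈A : ι ∈ A
  ι∈A = stabilizer⊆A ι ι-perm (λ x _ → lookup-ι x)

  τ∈A : τ ∈ A
  τ∈A = stabilizer⊆A τ τ-perm
    (λ x x∈B → τ-fixes x (B<t x x∈B) (λ { refl → j∉B x∈B }))

foldr-⊔-upper-bound : ∀ {X : Set} (f : X → ℕ) {xs : List X} {x : X} →
  x ∈ xs → f x ≤ foldr (λ y acc → f y ⊔ acc) 0 xs
foldr-⊔-upper-bound f {y ∷ _} (here refl) = m≤m⊔n (f y) _
foldr-⊔-upper-bound f {y ∷ _} (there x∈xs) =
  ≤-trans (foldr-⊔-upper-bound f x∈xs) (m≤n⊔m (f y) _)

-- Every point of a generator B ∈ g lies below s⁺(g) (0-based, so x+1 ≤ s⁺(g)).
generator-below-s⁺g : ∀ {n} {g : List (Subset n)} {B : Subset n} → B ∈ g → Below (s⁺g g) B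
generator-below-s⁺g {n} {g} {B} B∈g x x∈B = ≤-trans x≤s⁺B (foldr-⊔-upper-bound s⁺ B∈g)
  where
  x≤s⁺B : suc (toℕ x) ≤ s⁺ B
  x≤s⁺B = subst (λ b → (if b then suc (toℕ x) else 0) ≤ s⁺ B) ([]=⇒lookup x∈B)
    (foldr-⊔-upper-bound (λ i → if lookup B i then suc (toℕ i) else 0) (∈-allFin x))

generator-stabilizer⊆ : ∀ {n} {A : Family n} {g : List (Subset n)} {B : Subset n} →
  IsGen A g → B ∈ g → ∀ σ → IsPerm σ → B ⊆fix σ → σ ∈ A
generator-stabilizer⊆ (_ , generates) B∈g σ σ-perm B⊆fixσ =
  from (generates σ σ-perm) (lose B∈g B⊆fixσ)

generator-exists : ∀ {n} {A : Family n} {g : List (Subset n)} →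
  All IsPerm A → A ≢ [] → IsGen A g → ∃ λ B → B ∈ g
generator-exists {A = []}    _            A≢[] _ = contradiction refl A≢[]
generator-exists {A = σ ∷ _} (σ-perm ∷ _) _    (_ , generates)
  with find (to (generates σ σ-perm) (here refl))
... | B , B∈g , _ = B , B∈g

-- First part: s⁺(g) ≥ t.  A generator lying below t would, by the key lemma,
-- contain the point t-1, which forces s⁺(g) ≥ t after all.
s⁺g-lower-bound : ∀ {n t} {A : Family n} {g : List (Subset n)} → InI n t A → 1 ≤ t → t < n →
  A ≢ [] → IsGen A g → t ≤ s⁺g g
s⁺g-lower-bound {n} {suc t′} {g = g} A∈I _ t<n A≢[] gen
  with generator-exists (proj₁ A∈I) A≢[] gen | suc t′ ≤? s⁺g g
... | _ , _   | yes t≤s⁺g = t≤s⁺g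
... | B , B∈g | no t≰s⁺g  = contradiction t≤s⁺g t≰s⁺g
  where
  B<t : Below (suc t′) B
  B<t x x∈B = <-trans (generator-below-s⁺g B∈g x x∈B) (≰⇒> t≰s⁺g)

  last : Fin n
  last = fromℕ< (<-trans (s≤s ≤-refl) t<n)

  last∈B : last S.∈ B
  last∈B = prefix-generator-is-full A∈I t<n (generator-stabilizer⊆ gen B∈g) B<t last
    (subst (_< suc t′) (sym (toℕ-fromℕ< _)) (s≤s ≤-refl))

  t≤s⁺g : suc t′ ≤ s⁺g g
  t≤s⁺g = subst (λ k → suc k ≤ s⁺g g) (toℕ-fromℕ< _) (generator-below-s⁺g B∈g last last∈B)

-- Second part, step 1: if s⁺(g) = t then every generator is exactly [0,t), so
-- σ ∈ A if and only if σ fixes [0,t).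
height-t-generators⇒prefix-criterion : ∀ {n t} {A : Family n} {g : List (Subset n)} →
  InI n t A → t < n → A ≢ [] → IsGen A g → s⁺g g ≡ t →
  ∀ σ → IsPerm σ → σ ∈ A ⇔ FixesPrefix t σ
height-t-generators⇒prefix-criterion {t = t} {A} {g} A∈I t<n A≢[] gen s⁺g≡t σ σ-perm =
  mk⇔ fixes-prefix fixes-prefix⇒∈A
  where
  below-t : ∀ {B} → B ∈ g → Below t B
  below-t B∈g x x∈B = subst (toℕ x <_) s⁺g≡t (generator-below-s⁺g B∈g x x∈B)

  fixes-prefix : σ ∈ A → FixesPrefix t σ
  fixes-prefix σ∈A x x<t with find (to (proj₂ gen σ σ-perm) σ∈A)
  ... | B , B∈g , B⊆fixσ = B⊆fixσ x
    (prefix-generator-is-full A∈I t<n (generator-stabilizer⊆ gen B∈g) (below-t B∈g) x x<t)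

  fixes-prefix⇒∈A : FixesPrefix t σ → σ ∈ A
  fixes-prefix⇒∈A σ-fixes with generator-exists (proj₁ A∈I) A≢[] gen
  ... | B , B∈g = generator-stabilizer⊆ gen B∈g σ σ-perm
    (λ x x∈B → σ-fixes x (below-t B∈g x x∈B))

prefix-criterion⇒stabilizer : ∀ {n t} {A : Family n} → t ≤ n →
  (∀ σ → IsPerm σ → σ ∈ A ⇔ FixesPrefix t σ) → IsStabilizer t A
prefix-criterion⇒stabilizer {n} {t} {A} t≤n criterion =
  points , points-injective , λ σ σ-perm → mk⇔
    (λ σ∈A k → to (criterion σ σ-perm) σ∈A (lookup points k) (points<t k))
    (λ fixes-points → from (criterion σ σ-perm) (λ x x<t →
       subst (λ y → lookup σ y ≡ y) (points-fromℕ< x<t) (fixes-points (fromℕ< x<t))))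
  where
  points : Vec (Fin n) t
  points = tabulate (λ k → inject≤ k t≤n)

  toℕ-points : ∀ k → toℕ (lookup points k) ≡ toℕ k
  toℕ-points k = trans (cong toℕ (lookup∘tabulate _ k)) (toℕ-inject≤ k t≤n)

  points-injective : ∀ k l → lookup points k ≡ lookup points l → k ≡ l
  points-injective k l eq = toℕ-injective
    (trans (sym (toℕ-points k)) (trans (cong toℕ eq) (toℕ-points l)))

  points<t : ∀ k → toℕ (lookup points k) < t
  points<t k = subst (_< t) (sym (toℕ-points k)) (toℕ<n k)

  points-fromℕ< : ∀ {x : Fin n} (x<t : toℕ x < t) → lookup points (fromℕ< x<t) ≡ x
  points-fromℕ< x<t = toℕ-injective (trans (toℕ-points _) (toℕ-fromℕ< x<t))

lemma2p11 : (t n : ℕ) → 1 ≤ t → t + 1 ≤ n → (A : Family n) → InI n t A → A ≢ [] →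
    (∀ g → IsGen A g → t ≤ s⁺g g) × (SMinIs A t → IsStabilizer t A)
lemma2p11 t n 1≤t t+1≤n A A∈I A≢[] =
    (λ g gen → s⁺g-lower-bound A∈I 1≤t t<n A≢[] gen)
  , λ { ((g , gen , s⁺g≡t) , _) → prefix-criterion⇒stabilizer (<⇒≤ t<n)
          (height-t-generators⇒prefix-criterion A∈I t<n A≢[] gen s⁺g≡t) }
  where
  t<n : t < n
  t<n = subst (_≤ n) (+-comm t 1) t+1≤n
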